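{- Let $q\geq 4$ be even, let $k\geq 2$ and $n\geq 0$ be integers, let $N$ be the number of strings in the list $\mathcal F_n^{(k)}$, and let $\alpha_1,\ldots,\alpha_N$ be the elements of $\mathcal F_n^{(k)}$ in order. Then the list $$\mathcal F_{n,q}^{(k)}=\varepsilon(\alpha_1)\circ\overline{\varepsilon(\alpha_2)}\circ\varepsilon(\alpha_3)\circ\overline{\varepsilon(\alpha_4)}\circ\cdots\circ\varepsilon'(\alpha_N),$$ where the expansions are taken in direct order for odd indices and in reversed order for even indices (so $\varepsilon'(\alpha_N)=\varepsilon(\alpha_N)$ if $N$ is odd and $\varepsilon'(\alpha_N)=\overline{\varepsilon(\alpha_N)}$ if $N$ is even), is a Gray code list with Hamming distance 1: any two consecutive strings in it differ in exactly one position.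
   Context: Lists are finite ordered sequences of strings. For a list $\mathcal L$, $\overline{\mathcal L}$ is $\mathcal L$ in reverse order; for a string $u$, $u\cdot\mathcal L$ is the list obtained by prepending $u$ to every string of $\mathcal L$; $\mathcal L\circ\mathcal L'$ is concatenation of lists; $\lambda$ is the empty string and $0^j$ is the string of $j$ zeros. Binary lists: $\mathcal C_0=(\lambda)$ and $\mathcal C_n=1\cdot\overline{\mathcal C_{n-1}}\circ 0\cdot\mathcal C_{n-1}$ for $n\ge1$; for fixed $k\ge2$, $\mathcal F_n^{(k)}=\mathcal C_n$ if $0\le n<k$, and $\mathcal F_n^{(k)}=1\cdot\overline{\mathcal F_{n-1}^{(k)}}\circ 01\cdot\overline{\mathcal F_{n-2}^{(k)}}\circ 001\cdot\overline{\mathcal F_{n-3}^{(k)}}\circ\cdots\circ 0^{k-1}1\cdot\overline{\mathcal F_{n-k}^{(k)}}$ if $n\ge k$ (this is a list of the binary strings of length $n$ avoiding $k$ consecutive 0's). For an ordered alphabet $(a_0,\ldots,a_{r-1})$, the reflected Gray code is $\mathcal G_0^r=(\lambda)$ and, for $n>0$, $\mathcal G_n^r=a_0\cdot\mathcal G_{n-1}^r\circ a_1\cdot\overline{\mathcal G_{n-1}^r}\circ a_2\cdot\mathcal G_{n-1}^r\circ\cdots$, where the block with prefix $a_i$ uses $\mathcal G_{n-1}^r$ for even $i$ and $\overline{\mathcal G_{n-1}^r}$ for odd $i$. Let $\mathcal G_t^{q-1}\oplus1$ denote $\mathcal G_t^{q-1}$ over the ordered alphabet $(1,2,\ldots,q-1)$.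 For a binary string $\beta$ with exactly $t$ ones, the expansion $\varepsilon(\beta)$ is the list of $(q-1)^t$ strings whose $i$-th element is obtained from $\beta$ by replacing its $t$ ones, from left to right, by the symbols of the $i$-th string of $\mathcal G_t^{q-1}\oplus1$. The resulting list $\mathcal F_{n,q}^{(k)}$ lists the strings of length $n$ over $\{0,1,\ldots,q-1\}$ avoiding $k$ consecutive 0's. -}

module Defs where

open import Data.Nat using (ℕ; zero; suc; _∸_; _<ᵇ_)
open import Data.Nat.Properties using ()
open import Data.List using (List; []; _∷_; _++_; map; reverse; concat; upTo; replicate; length)
open import Data.Bool using (Bool; true; false; if_then_else_; not)
open import Relation.Binary.PropositionalEquality using (_≡_; _≢_)

Str : Set
Str = List ℕ

C : ℕ → List Str
C zero    = [] ∷ []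
C (suc n) = map (1 ∷_) (reverse (C n)) ++ map (0 ∷_) (C n)

-- F_n^{(k)} computed with fuel (fuel ≥ n+1 always suffices, since n ∸ i < n in the
-- recursive case n ≥ k ≥ 1, i ∈ {1..k}).
F′ : ℕ → ℕ → ℕ → List Str
F′ zero       k n = C n
F′ (suc fuel) k n with n <ᵇ k
... | true  = C n
... | false = concat (map block (map suc (upTo k)))
  where
  block : ℕ → List Str
  block i = map (λ s → replicate (i ∸ 1) 0 ++ (1 ∷ s)) (reverse (F′ fuel k (n ∸ i)))

F : ℕ → ℕ → List Str
F k n = F′ (suc n) k n

G : (r : ℕ) → (ℕ → ℕ) → ℕ → List Str
G r a zero    = [] ∷ []
G r a (suc n) = concat (map blk (upTo r))
  where
  even? : ℕ → Bool
  even? zero          = true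
  even? (suc zero)    = false
  even? (suc (suc i)) = even? i
  blk : ℕ → List Str
  blk i = map (a i ∷_) (if even? i then G r a n else reverse (G r a n))

Gplus1 : ℕ → ℕ → List Str
Gplus1 q t = G (q ∸ 1) suc t

ones : Str → ℕ
ones []          = 0
ones (zero ∷ β)  = ones β
ones (suc _ ∷ β) = suc (ones β)

fill : Str → Str → Str
fill []          g       = []
fill (zero ∷ β)  g       = 0 ∷ fill β g
fill (suc _ ∷ β) []      = []          -- unreachable when length g = ones β
fill (suc _ ∷ β) (x ∷ g) = x ∷ fill β g

expand : ℕ → Str → List Str
expand q β = map (fill β) (Gplus1 q (ones β))

alternate : ℕ → Bool → List Str → List Str
alternate q b []      = []
alternate q b (α ∷ αs) =
  (if b then expand q α else reverse (expand q α)) ++ alternate q (not b) αs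

Fq : ℕ → ℕ → ℕ → List Str
Fq q k n = alternate q true (F k n)

data DiffOne : Str → Str → Set where
  here  : ∀ {x y xs} → x ≢ y → DiffOne (x ∷ xs) (y ∷ xs)
  there : ∀ {x xs ys} → DiffOne xs ys → DiffOne (x ∷ xs) (x ∷ ys)

-- Consecutive strings of the binary list F_n^(k) differ by flipping a single
-- position between 0 and non-zero.  For odd r = q − 1 the reflected code G_t^r
-- runs from 1^t to r^t, so ε(α) runs from α with its ones replaced by 1 to α
-- with its ones replaced by q − 1, and its reverse runs back.  Alternating the
-- direction makes each expansion start from the same constant filling at which
-- the previous one ended; two such fillings of flip-adjacent binary strings
-- differ exactly at the flipped position.
module Submission where

open import Defs

open import Data.Bool using (Bool; T; true; false; if_then_else_; not)
open import Data.Bool.Properties using (if-not; not-involutive)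
open import Data.List using (List; []; _∷_; [_]; _++_; map; reverse; concat; upTo; applyUpTo; replicate; length)
open import Data.List.Properties using (++-identityʳ; unfold-reverse; map-∘; map-upTo; length-replicate)
open import Data.List.Relation.Unary.Linked using (Linked; [-]; _∷_)
open import Data.Nat using (ℕ; zero; suc; _+_; _∸_; _≤_; _<_; _<ᵇ_; _<?_; z≤n; s≤s; z<s)
open import Data.Nat.Divisibility using (_∣_; divides)
open import Data.Nat.Induction using (<-rec)
open import Data.Nat.Properties using (<⇒<ᵇ; <ᵇ⇒<; ≤⇒≯; <-trans; ≮⇒≥; ≤-trans; ≤-refl; <-≤-trans; ∸-monoʳ-<; +-∸-assoc; +-suc; +-identityʳ; *-comm; suc-injective; 1+n≢n)
open import Data.Product using (∃; _,_; proj₂)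
open import Function using (_∘_)
open import Relation.Nullary using (yes; no; contradiction)
open import Relation.Binary.PropositionalEquality using (_≡_; _≢_; refl; sym; trans; cong; cong₂; subst; subst₂; module ≡-Reasoning)

data Path {A : Set} (R : A → A → Set) : A → List A → A → Set where
  stop : ∀ {x} → Path R x [ x ] x
  step : ∀ {x y ys z} → R x y → Path R y ys z → Path R x (x ∷ ys) z

module _ {A : Set} {R : A → A → Set} where

  path⇒linked : ∀ {x xs y} → Path R x xs y → Linked R xs
  path⇒linked stop                = [-]
  path⇒linked (step r stop)       = r ∷ [-]
  path⇒linked (step r p@(step _ _)) = r ∷ path⇒linked p

  path-++ : ∀ {x xs y u us z} → Path R x xs y → R y u → Path R u us z → Path R x (xs ++ us) z
  path-++ stop        r q = step r q
  path-++ (step r′ p) r q = step r′ (path-++ p r q)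

  path-reverse : (∀ {x y} → R x y → R y x) → ∀ {x xs y} → Path R x xs y → Path R y (reverse xs) x
  path-reverse R-sym stop = stop
  path-reverse R-sym (step {x = x} {ys = ys} r p) =
    subst (λ zs → Path R _ zs x) (sym (unfold-reverse x ys)) (path-++ (path-reverse R-sym p) (R-sym r) stop)

  path-orient : (∀ {x y} → R x y → R y x) → ∀ b {x xs y} → Path R x xs y →
                Path R (if b then x else y) (if b then xs else reverse xs) (if b then y else x)
  path-orient R-sym true  p = p
  path-orient R-sym false p = path-reverse R-sym p

  path-map : ∀ {B : Set} {S : B → B → Set} (f : A → B) → (∀ {x y} → R x y → S (f x) (f y)) →
             ∀ {x xs y} → Path R x xs y → Path S (f x) (map f xs) (f y)
  path-map f g stop       = stop
  path-map f g (step r p) = step (g r) (path-map f g p)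

  path-concat : ∀ c (h : ℕ → List A) (x y : ℕ → A) →
                (∀ j → j ≤ c → Path R (x j) (h j) (y j)) →
                (∀ j → j < c → R (y j) (x (suc j))) →
                Path R (x 0) (concat (applyUpTo h (suc c))) (y c)
  path-concat zero h x y block junction =
    subst (λ zs → Path R (x 0) zs (y 0)) (sym (++-identityʳ (h 0))) (block 0 z≤n)
  path-concat (suc c) h x y block junction =
    path-++ (block 0 z≤n) (junction 0 z<s)
      (path-concat c (h ∘ suc) (x ∘ suc) (y ∘ suc) (λ j → block (suc j) ∘ s≤s) (λ j → junction (suc j) ∘ s≤s))

data Flip : Str → Str → Set where
  clear : ∀ {x xs} → Flip (suc x ∷ xs) (0 ∷ xs)
  set   : ∀ {x xs} → Flip (0 ∷ xs) (suc x ∷ xs)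
  there : ∀ {x xs ys} → Flip xs ys → Flip (x ∷ xs) (x ∷ ys)

Flip-sym : ∀ {xs ys} → Flip xs ys → Flip ys xs
Flip-sym clear     = set
Flip-sym set       = clear
Flip-sym (there f) = there (Flip-sym f)

Flip-zeros : ∀ j {xs ys} → Flip xs ys → Flip (replicate j 0 ++ xs) (replicate j 0 ++ ys)
Flip-zeros zero    f = f
Flip-zeros (suc j) f = there (Flip-zeros j f)

Flip-lower : ∀ j {x xs} → Flip (replicate j 0 ++ suc x ∷ xs) (replicate (suc j) 0 ++ xs)
Flip-lower zero    = clear
Flip-lower (suc j) = there (Flip-lower j)

DiffOne-sym : ∀ {xs ys} → DiffOne xs ys → DiffOne ys xs
DiffOne-sym (here x≢y) = here (x≢y ∘ sym)
DiffOne-sym (there d)  = there (DiffOne-sym d)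

DiffOne-length : ∀ {xs ys} → DiffOne xs ys → length xs ≡ length ys
DiffOne-length (here _)  = refl
DiffOne-length (there d) = cong suc (DiffOne-length d)

fill-DiffOne : ∀ α {g g′} → DiffOne g g′ → length g ≡ ones α → DiffOne (fill α g) (fill α g′)
fill-DiffOne []          (here _)   ()
fill-DiffOne []          (there _)  ()
fill-DiffOne (zero ∷ α)  d          len = there (fill-DiffOne α d len)
fill-DiffOne (suc _ ∷ α) (here x≢y) len = here x≢y
fill-DiffOne (suc _ ∷ α) (there d)  len = there (fill-DiffOne α d (suc-injective len))

path-fill : ∀ α {g gs g′} → Path DiffOne g gs g′ → length g ≡ ones α →
            Path DiffOne (fill α g) (map (fill α) gs) (fill α g′)
path-fill α stop       len = stop
path-fill α (step d p) len = step (fill-DiffOne α d len) (path-fill α p (trans (sym (DiffOne-length d)) len))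

fill-Flip : ∀ {c α β} → c ≢ 0 → Flip α β →
            DiffOne (fill α (replicate (ones α) c)) (fill β (replicate (ones β) c))
fill-Flip c≢0 clear             = here c≢0
fill-Flip c≢0 set               = here (c≢0 ∘ sym)
fill-Flip c≢0 (there {zero} f)  = there (fill-Flip c≢0 f)
fill-Flip c≢0 (there {suc _} f) = there (fill-Flip c≢0 f)

-- The three equations on ev are the defining clauses of the parity test local
-- to G, so at G they hold by refl.
G-step : ∀ {a : ℕ → ℕ} → (∀ i → a i ≢ a (suc i)) → ∀ m (ev : ℕ → Bool) →
         ev 0 ≡ true → ev 1 ≡ false → (∀ i → ev (suc (suc i)) ≡ ev i) →
         ∀ {s L e} → Path DiffOne s L e →
         Path DiffOne (a 0 ∷ s)
           (concat (map (λ i → map (a i ∷_) (if ev i then L else reverse L)) (upTo (suc (m + m)))))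
           (a (m + m) ∷ e)
G-step {a} distinct m ev ev0 ev1 ev2 {s} {L} {e} P =
  subst₂ (λ u v → Path DiffOne u (concat blocks) v) (cong (λ b → a 0 ∷ (if b then s else e)) ev0)
    (cong (λ b → a (m + m) ∷ (if b then e else s)) (ev-double m))
    (subst (λ zs → Path DiffOne (x 0) (concat zs) (y (m + m))) (sym (map-upTo h (suc (m + m))))
      (path-concat (m + m) h x y block junction))
  where
  h : ℕ → List Str
  h i = map (a i ∷_) (if ev i then L else reverse L)
  blocks : List (List Str)
  blocks = map h (upTo (suc (m + m)))
  x y : ℕ → Str
  x i = a i ∷ (if ev i then s else e)
  y i = a i ∷ (if ev i then e else s)
  ev-suc : ∀ i → ev (suc i) ≡ not (ev i)
  ev-suc zero    = trans ev1 (cong not (sym ev0))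
  ev-suc (suc i) = trans (ev2 i) (trans (sym (not-involutive (ev i))) (cong not (sym (ev-suc i))))
  ev-double : ∀ n → ev (n + n) ≡ true
  ev-double zero    = ev0
  ev-double (suc n) = trans (cong (ev ∘ suc) (+-suc n n)) (trans (ev2 (n + n)) (ev-double n))
  block : ∀ j → j ≤ m + m → Path DiffOne (x j) (h j) (y j)
  block j _ = path-map (a j ∷_) there (path-orient DiffOne-sym (ev j) P)
  junction : ∀ j → j < m + m → DiffOne (y j) (x (suc j))
  junction j _ = subst (λ w → DiffOne (y j) (a (suc j) ∷ w))
    (sym (trans (cong (λ b → if b then s else e) (ev-suc j)) (if-not (ev j)))) (here (distinct j))

G-path : ∀ (a : ℕ → ℕ) → (∀ i → a i ≢ a (suc i)) → ∀ m t →
         Path DiffOne (replicate t (a 0)) (G (suc (m + m)) a t) (replicate t (a (m + m)))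
G-path a distinct m zero    = stop
G-path a distinct m (suc t) = G-step distinct m _ refl refl (λ _ → refl) (G-path a distinct m t)

corner : ℕ → Bool → Str → Str
corner q b α = fill α (replicate (ones α) (if b then 1 else q ∸ 1))

module _ {q m : ℕ} (q-odd : q ∸ 1 ≡ suc (m + m)) where

  corner-Flip : ∀ b {α β} → Flip α β → DiffOne (corner q b α) (corner q b β)
  corner-Flip true  = fill-Flip λ ()
  corner-Flip false = fill-Flip λ q-1≡0 → contradiction (trans (sym q-odd) q-1≡0) λ ()

  expand-path : ∀ α → Path DiffOne (corner q true α) (expand q α) (corner q false α)
  expand-path α rewrite q-odd =
    path-fill α (G-path suc (λ _ → 1+n≢n ∘ sym) m (ones α)) (length-replicate (ones α))

  expand-oriented-path : ∀ b α →
    Path DiffOne (corner q b α) (if b then expand q α else reverse (expand q α)) (corner q (not b) α)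
  expand-oriented-path true  α = expand-path α
  expand-oriented-path false α = path-reverse DiffOne-sym (expand-path α)

  alternate-path : ∀ b {α αs ω} → Path Flip α αs ω →
                   ∃ λ z → Path DiffOne (corner q b α) (alternate q b αs) z
  alternate-path b {α} stop =
    _ , subst (λ zs → Path DiffOne (corner q b α) zs (corner q (not b) α)) (sym (++-identityʳ _))
              (expand-oriented-path b α)
  alternate-path b {α} (step f p) with alternate-path (not b) p
  ... | z , P = z , path-++ (expand-oriented-path b α) (corner-Flip (not b) f) P

even⇒pred-odd : ∀ {q} → 2 ∣ q → 0 < q → ∃ λ m → q ∸ 1 ≡ suc (m + m)
even⇒pred-odd (divides (suc m) refl) _ =
  m , cong suc (trans (*-comm m 2) (cong (m +_) (+-identityʳ m)))

-- The junk value [] is never used: these are only applied to lists carrying a path.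
first final : List Str → Str
first []      = []
first (x ∷ _) = x
final []           = []
final (x ∷ [])     = x
final (_ ∷ y ∷ ys) = final (y ∷ ys)

module _ {R : Str → Str → Set} where

  path-first : ∀ {x xs y} → Path R x xs y → first xs ≡ x
  path-first stop       = refl
  path-first (step _ _) = refl

  path-first-++ : ∀ {x xs y} ys → Path R x xs y → first (xs ++ ys) ≡ x
  path-first-++ ys stop       = refl
  path-first-++ ys (step _ _) = refl

  path-final : ∀ {x xs y} → Path R x xs y → final xs ≡ y
  path-final stop                  = refl
  path-final (step _ stop)         = refl
  path-final (step _ p@(step _ _)) = path-final p

Chain : List Str → Set
Chain xs = Path Flip (first xs) xs (final xs)

path⇒chain : ∀ {x xs y} → Path Flip x xs y → Chain xs
path⇒chain {xs = xs} p =
  subst₂ (λ u v → Path Flip u xs v) (sym (path-first p)) (sym (path-final p)) p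

first-reflected : ∀ {xs} ys → Chain xs → first (map (1 ∷_) (reverse xs) ++ ys) ≡ 1 ∷ final xs
first-reflected ys c = path-first-++ {R = Flip} ys (path-map (1 ∷_) there (path-reverse Flip-sym c))

C-chain : ∀ n → Chain (C n)
C-chain zero    = stop
C-chain (suc n) =
  path⇒chain (path-++ (path-map (1 ∷_) there (path-reverse Flip-sym (C-chain n))) (clear {x = 0})
                      (path-map (0 ∷_) there (C-chain n)))

C-first : ∀ n → first (C (suc n)) ≡ 1 ∷ final (C n)
C-first n = first-reflected (map (0 ∷_) (C n)) (C-chain n)

applyUpTo-cong : ∀ {A : Set} {f g : ℕ → A} k → (∀ j → j < k → f j ≡ g j) → applyUpTo f k ≡ applyUpTo g k
applyUpTo-cong zero    eq = refl
applyUpTo-cong (suc k) eq = cong₂ _∷_ (eq 0 z<s) (applyUpTo-cong k (λ j → eq (suc j) ∘ s≤s))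

F-block : (ℕ → List Str) → ℕ → ℕ → List Str
F-block Fm n j = map (λ s → replicate j 0 ++ 1 ∷ s) (reverse (Fm (n ∸ suc j)))

Fstep : (ℕ → List Str) → ℕ → ℕ → List Str
Fstep Fm k n = concat (applyUpTo (F-block Fm n) k)

Fstep-cong : ∀ {Fm Fm′ : ℕ → List Str} k n → (∀ j → j < k → Fm (n ∸ suc j) ≡ Fm′ (n ∸ suc j)) →
             Fstep Fm k n ≡ Fstep Fm′ k n
Fstep-cong k n eq =
  cong concat (applyUpTo-cong k (λ j j<k → cong (map (λ s → replicate j 0 ++ 1 ∷ s) ∘ reverse) (eq j j<k)))

m∸[1+n]<m : ∀ {m n} → suc n ≤ m → m ∸ suc n < m
m∸[1+n]<m = ∸-monoʳ-< z<s

F′-small : ∀ f {k n} → n < k → F′ (suc f) k n ≡ C n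
F′-small f {k} {n} n<k with n <ᵇ k in eq
... | true  = refl
... | false = contradiction (subst T eq (<⇒<ᵇ n<k)) λ ()

F′-unfold : ∀ f {k n} → k ≤ n → F′ (suc f) k n ≡ Fstep (F′ f k) k n
F′-unfold f {k} {n} k≤n with n <ᵇ k in eq
... | true  = contradiction (<ᵇ⇒< n k (subst T (sym eq) _)) (≤⇒≯ k≤n)
... | false = cong concat (trans (sym (map-∘ (upTo k))) (map-upTo _ k))

F′-fuel-irrelevant : ∀ {k f f′ n} → n < f → n < f′ → F′ f k n ≡ F′ f′ k n
F′-fuel-irrelevant {k} {suc f} {suc f′} {n} (s≤s n≤f) (s≤s n≤f′) with n <? k
... | yes n<k = trans (F′-small f n<k) (sym (F′-small f′ n<k))
... | no n≮k = begin
  F′ (suc f) k n      ≡⟨ F′-unfold f k≤n ⟩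
  Fstep (F′ f k) k n  ≡⟨ Fstep-cong {F′ f k} {F′ f′ k} k n
                          (λ j j<k → F′-fuel-irrelevant (shrink j<k n≤f) (shrink j<k n≤f′)) ⟩
  Fstep (F′ f′ k) k n ≡⟨ F′-unfold f′ k≤n ⟨
  F′ (suc f′) k n     ∎
  where
  open ≡-Reasoning
  k≤n = ≮⇒≥ n≮k
  shrink : ∀ {j g} → j < k → n ≤ g → n ∸ suc j < g
  shrink j<k n≤g = <-≤-trans (m∸[1+n]<m (≤-trans j<k k≤n)) n≤g

F-small : ∀ {k n} → n < k → F k n ≡ C n
F-small = F′-small _

F-step : ∀ {k n} → k ≤ n → F k n ≡ Fstep (F k) k n
F-step {k} {n} k≤n =
  trans (F′-unfold n k≤n)
        (Fstep-cong {F′ n k} {F k} k n (λ j j<k → F′-fuel-irrelevant (m∸[1+n]<m (≤-trans j<k k≤n)) ≤-refl))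

F-first : ∀ c m → Chain (F (suc c) m) → first (F (suc c) (suc m)) ≡ 1 ∷ final (F (suc c) m)
F-first c m ch with suc m <? suc c
... | yes m+1<k = trans (cong first (F-small m+1<k))
                        (trans (C-first m) (cong (λ zs → 1 ∷ final zs) (sym (F-small (<-trans ≤-refl m+1<k)))))
... | no m+1≮k = trans (cong first (F-step (≮⇒≥ m+1≮k))) (first-reflected _ ch)

F-chain : ∀ c n → Chain (F (suc c) n)
F-chain c = <-rec (λ n → Chain (F k n)) chain
  where
  k = suc c
  chain : ∀ n → (∀ {m} → m < n → Chain (F k m)) → Chain (F k n)
  chain n ih with n <? k
  ... | yes n<k = subst Chain (sym (F-small n<k)) (C-chain n)
  ... | no n≮k = subst Chain (sym (F-step k≤n)) (path⇒chain (path-concat c (F-block (F k) n) x y block junction))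
    where
    k≤n = ≮⇒≥ n≮k
    x y : ℕ → Str
    x j = replicate j 0 ++ 1 ∷ final (F k (n ∸ suc j))
    y j = replicate j 0 ++ 1 ∷ first (F k (n ∸ suc j))
    block : ∀ j → j ≤ c → Path Flip (x j) (F-block (F k) n j) (y j)
    block j j≤c = path-map (λ s → replicate j 0 ++ 1 ∷ s) (Flip-zeros j ∘ there)
                    (path-reverse Flip-sym (ih (m∸[1+n]<m (≤-trans (s≤s j≤c) k≤n))))
    junction : ∀ j → j < c → Flip (y j) (x (suc j))
    junction j j<c = subst (λ s → Flip (replicate j 0 ++ 1 ∷ s) (x (suc j))) (sym first≡) (Flip-lower j)
      where
      j+2≤n : suc (suc j) ≤ n
      j+2≤n = ≤-trans (s≤s j<c) k≤n
      first≡ : first (F k (n ∸ suc j)) ≡ 1 ∷ final (F k (n ∸ suc (suc j)))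
      first≡ = trans (cong (first ∘ F k) (+-∸-assoc 1 j+2≤n)) (F-first c _ (ih (m∸[1+n]<m j+2≤n)))

proposition4 : (q k n : ℕ) → 2 ∣ q → 4 ≤ q → 2 ≤ k → Linked DiffOne (Fq q k n)
proposition4 q (suc c) n 2∣q 4≤q _ with even⇒pred-odd 2∣q (≤-trans (s≤s z≤n) 4≤q)
... | m , q-odd = path⇒linked (proj₂ (alternate-path {q} {m} q-odd true (F-chain c n)))
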